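{- Let $G$ be a $3$-connected graph and $v\in V(G)$. If $G$ has no pair of vertex-disjoint cycles one of which contains $v$, then $G$ has no pair of vertex-disjoint cycles.
   Context: Graphs are finite, without loops or parallel edges. -}

module Defs where

open import Data.Nat using (ℕ; _≤_; suc)
open import Data.Fin using (Fin)
open import Data.List using (List; []; _∷_; _++_; [_]; length)
open import Data.List.Relation.Unary.Linked using (Linked)
open import Data.List.Relation.Unary.Unique.Propositional using (Unique)
open import Data.List.Membership.Propositional using (_∈_; _∉_)
open import Data.Product using (Σ; ∃; ∃-syntax; _×_)
open import Data.Sum using (_⊎_)
open import Relation.Binary.PropositionalEquality using (_≡_)
open import Relation.Nullary using (¬_)

record Graph (n : ℕ) : Set₁ where
  field
    Adj    : Fin n → Fin n → Set
    sym    : ∀ {u v} → Adj u v → Adj v u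
    irrefl : ∀ {u} → ¬ Adj u u
open Graph public

module _ {n : ℕ} (G : Graph n) where

  IsCycle : List (Fin n) → Set
  IsCycle c = (3 ≤ length c) × Unique c ×
              (∃[ x ] ∃[ xs ] (c ≡ x ∷ xs) × Linked (Adj G) (x ∷ xs ++ [ x ]))

  -- u reaches w in G - S (u itself assumed outside S by the caller).
  data Reach (S : List (Fin n)) : Fin n → Fin n → Set where
    here : ∀ {u} → Reach S u u
    step : ∀ {u v w} → Adj G u v → v ∉ S → Reach S v w → Reach S u w

  KConnected : ℕ → Set
  KConnected k = (k + 1 ≤ n) ×
    (∀ (S : List (Fin n)) → suc (length S) ≤ k →
       ∀ u w → u ∉ S → w ∉ S → Reach S u w)
    where open import Data.Nat using (_+_)

  VertexDisjoint : List (Fin n) → List (Fin n) → Set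
  VertexDisjoint c d = ∀ x → x ∈ c → x ∉ d

  HasDisjointCycles : Set
  HasDisjointCycles = ∃[ c ] ∃[ d ] IsCycle c × IsCycle d × VertexDisjoint c d

  HasDisjointCyclesThrough : Fin n → Set
  HasDisjointCyclesThrough v =
    ∃[ c ] ∃[ d ] IsCycle c × IsCycle d × VertexDisjoint c d × (v ∈ c ⊎ v ∈ d)

module Submission where

-- Let C, D be disjoint cycles and P a path from v meeting C ∪ D only in its
-- last vertex a, say on C; we induct on the length of P (v itself lies on
-- neither cycle).  By 3-connectivity some path from v to another vertex of C
-- avoids a; let w be its first vertex on C ∪ D.  If w ∈ C and p is its last
-- vertex on P, then p →P a →C w → p is a new cycle, disjoint from D and reached
-- from v by the part of P before p, which is shorter.  If w ∈ D, we hold paths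
-- P to C and Q to D, and a path from v to C avoiding both a and the end z of Q
-- enters C, where C is rerouted as before, or D, where the same construction
-- replaces D by a cycle D′ reached by a path shorter than Q.  Then P reaches
-- either C before D′, and we recurse on the length of Q, or D′ before C, and
-- we recurse on the length of P.

open import Defs
open import Data.Nat using (ℕ; zero; suc; _≤_; _<_; z≤n; s≤s; _+_)
open import Data.Nat.Properties using (≤-refl; ≤-trans; ≤-pred; +-comm; +-monoʳ-≤; m≤n⇒m≤1+n)
open import Data.Fin using (Fin; _≟_)
open import Data.List using (List; []; _∷_; _++_; length)
open import Data.List.Relation.Unary.Linked using (Linked; []; [-]; _∷_)
open import Data.List.Relation.Unary.Unique.Propositional using (Unique)
open import Data.List.Relation.Unary.AllPairs using ([]; _∷_)
open import Data.List.Relation.Unary.All using ([]; _∷_)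
open import Data.List.Relation.Unary.All.Properties using (¬Any⇒All¬; All¬⇒¬Any)
open import Data.List.Relation.Unary.Any using (here; there)
open import Data.List.Membership.Propositional using (_∈_; _∉_)
open import Data.List.Membership.Propositional.Properties using (∈-++⁻; ∈-length)
open import Data.List.Relation.Binary.Subset.Propositional using (_⊆_)
open import Data.Product using (∃-syntax; _×_; _,_; proj₁; proj₂; Σ-syntax)
open import Data.Sum using (_⊎_; inj₁; inj₂; [_,_]′; swap)
import Data.Sum as Sum
open import Data.Empty using (⊥; ⊥-elim)
open import Relation.Binary.PropositionalEquality using (_≡_; _≢_; refl; cong; subst)
import Relation.Binary.PropositionalEquality as ≡
open import Relation.Nullary using (¬_; yes; no)
open import Relation.Nullary.Decidable using (_⊎-dec_)
open import Relation.Unary using (Decidable)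

module _ {A : Set} where

  private variable
    x y z : A
    ps qs : List A

  ∈∉⇒≢ : y ∈ ps → x ∉ ps → x ≢ y
  ∈∉⇒≢ y∈ x∉ x≡y = x∉ (subst (_∈ _) (≡.sym x≡y) y∈)

  distinct₂⇒2≤length : x ∈ ps → y ∈ ps → x ≢ y → 2 ≤ length ps
  distinct₂⇒2≤length (here refl) (here refl) x≢x = ⊥-elim (x≢x refl)
  distinct₂⇒2≤length (here _)    (there y∈)  _   = s≤s (∈-length y∈)
  distinct₂⇒2≤length (there x∈)  _           _   = s≤s (∈-length x∈)

  distinct₃⇒3≤length : x ∈ ps → y ∈ ps → z ∈ ps →
                       x ≢ y → y ≢ z → x ≢ z → 3 ≤ length ps
  distinct₃⇒3≤length (here refl) (here refl) _           x≢y _   _   = ⊥-elim (x≢y refl)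
  distinct₃⇒3≤length (here refl) _           (here refl) _   _   x≢z = ⊥-elim (x≢z refl)
  distinct₃⇒3≤length _           (here refl) (here refl) _   y≢z _   = ⊥-elim (y≢z refl)
  distinct₃⇒3≤length (here _)    (there y∈)  (there z∈)  _   y≢z _   =
    s≤s (distinct₂⇒2≤length y∈ z∈ y≢z)
  distinct₃⇒3≤length (there x∈)  (here _)    (there z∈)  _   _   x≢z =
    s≤s (distinct₂⇒2≤length x∈ z∈ x≢z)
  distinct₃⇒3≤length (there x∈)  (there y∈)  (here _)    x≢y _   _   =
    s≤s (distinct₂⇒2≤length x∈ y∈ x≢y)
  distinct₃⇒3≤length (there x∈)  (there y∈)  (there z∈)  x≢y y≢z x≢z =
    m≤n⇒m≤1+n (distinct₃⇒3≤length x∈ y∈ z∈ x≢y y≢z x≢z)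

  linked-++⁻ˡ : ∀ {R : A → A → Set} ps → Linked R (ps ++ qs) → Linked R ps
  linked-++⁻ˡ []           _       = []
  linked-++⁻ˡ (_ ∷ [])     _       = [-]
  linked-++⁻ˡ (_ ∷ _ ∷ ps) (r ∷ l) = r ∷ linked-++⁻ˡ (_ ∷ ps) l

module Paths {n : ℕ} (G : Graph n) where

  open import Data.List.Membership.DecPropositional (_≟_ {n}) using (_∈?_)

  private variable
    u w x y z : Fin n
    ps qs rs : List (Fin n)
    S : List (Fin n)

  data Path : Fin n → Fin n → List (Fin n) → Set where
    single : ∀ x → Path x x (x ∷ [])
    cons   : Adj G x y → x ∉ ps → Path y w ps → Path x w (x ∷ ps)

  head∈ : Path u w ps → u ∈ ps
  head∈ (single _)   = here refl
  head∈ (cons _ _ _) = here refl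

  last∈ : Path u w ps → w ∈ ps
  last∈ (single _)   = here refl
  last∈ (cons _ _ p) = there (last∈ p)

  2≤length : u ≢ w → Path u w ps → 2 ≤ length ps
  2≤length u≢u (single _)   = ⊥-elim (u≢u refl)
  2≤length _   (cons _ _ p) = s≤s (∈-length (head∈ p))

  unique : Path u w ps → Unique ps
  unique (single _)    = [] ∷ []
  unique (cons _ u∉ p) = ¬Any⇒All¬ _ u∉ ∷ unique p

  record SplitAt (x u w : Fin n) (rs : List (Fin n)) : Set where
    field
      before after : List (Fin n)
      initial      : Path u x before
      final        : Path x w after
      before⊆      : before ⊆ rs
      after⊆       : after ⊆ rs
      meet         : ∀ {y} → y ∈ before → y ∈ after → y ≡ x
      cover        : ∀ {y} → y ∈ rs → y ∈ before ⊎ y ∈ after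
      length-split : length before + length after ≡ suc (length rs)

    open Data.Nat.Properties.≤-Reasoning

    before-≤ : length before ≤ length rs
    before-≤ = ≤-pred (begin
      suc (length before)           ≡⟨ +-comm 1 (length before) ⟩
      length before + 1             ≤⟨ +-monoʳ-≤ (length before) (∈-length (head∈ final)) ⟩
      length before + length after  ≡⟨ length-split ⟩
      suc (length rs)               ∎)

    before-< : x ≢ w → length before < length rs
    before-< x≢w = ≤-pred (begin
      suc (suc (length before))     ≡⟨ +-comm 2 (length before) ⟩
      length before + 2             ≤⟨ +-monoʳ-≤ (length before) (2≤length x≢w final) ⟩
      length before + length after  ≡⟨ length-split ⟩
      suc (length rs)               ∎)

  split-at-head : Path u w rs → SplitAt u u w rs
  split-at-head {u = u} p = record
    { before = u ∷ [] ; after = _ ; initial = single u ; final = p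
    ; before⊆ = λ { (here refl) → head∈ p } ; after⊆ = λ q → q
    ; meet = λ { (here refl) _ → refl } ; cover = inj₂ ; length-split = refl }

  split-cons : Adj G u y → u ∉ rs → SplitAt x y w rs → SplitAt x u w (u ∷ rs)
  split-cons u~y u∉ s = record
    { before = _ ∷ before ; after = after
    ; initial = cons u~y (λ q → u∉ (before⊆ q)) initial ; final = final
    ; before⊆ = λ { (here refl) → here refl ; (there q) → there (before⊆ q) }
    ; after⊆ = λ q → there (after⊆ q)
    ; meet = λ { (here refl) q → ⊥-elim (u∉ (after⊆ q)) ; (there q) q′ → meet q q′ }
    ; cover = λ { (here refl) → inj₁ (here refl) ; (there q) → Sum.map₁ there (cover q) }
    ; length-split = cong suc length-split }
    where open SplitAt s

  record FirstHit (T : Fin n → Set) (u w : Fin n) (rs : List (Fin n)) : Set where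
    field
      hit   : Fin n
      T-hit : T hit
      split : SplitAt hit u w rs
    open SplitAt split public
    field
      first : ∀ {y} → y ∈ before → T y → y ≡ hit

  module _ {T : Fin n → Set} (T? : Decidable T) where

    first-hit : Path u w rs → (∀ {y} → y ∈ rs → ¬ T y) ⊎ FirstHit T u w rs
    first-hit {u = u} p with T? u
    ... | yes Tu = inj₂ record
      { hit = u ; T-hit = Tu ; split = split-at-head p ; first = λ { (here refl) _ → refl } }
    first-hit (single _) | no ¬Tu = inj₁ λ { (here refl) → ¬Tu }
    first-hit (cons u~y u∉ p) | no ¬Tu with first-hit p
    ... | inj₁ none = inj₁ λ { (here refl) → ¬Tu ; (there q) → none q }
    ... | inj₂ h = inj₂ record
      { hit = hit ; T-hit = T-hit ; split = split-cons u~y u∉ split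
      ; first = λ { (here refl) Tu → ⊥-elim (¬Tu Tu) ; (there q) → first q } }
      where open FirstHit h

  split-at : Path u w rs → x ∈ rs → SplitAt x u w rs
  split-at {u = u} {w = w} {rs = rs} {x = x} p x∈ with first-hit (_≟ x) p
  ... | inj₁ none = ⊥-elim (none x∈ refl)
  ... | inj₂ h = subst (λ t → SplitAt t u w rs) (FirstHit.T-hit h) (FirstHit.split h)

  snoc : Path u w ps → Adj G w x → x ∉ ps → Path u x (ps ++ x ∷ [])
  snoc (single _) w~x x∉ = cons w~x (λ { (here refl) → x∉ (here refl) }) (single _)
  snoc {x = x} (cons {x = u} {ps = ps} u~y u∉ p) w~x x∉ =
    cons u~y u∉ps++x (snoc p w~x (λ q → x∉ (there q)))
    where
      u∉ps++x : u ∉ ps ++ x ∷ []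
      u∉ps++x q with ∈-++⁻ ps q
      ... | inj₁ u∈ps        = u∉ u∈ps
      ... | inj₂ (here refl) = x∉ (here refl)

  reverse : Path u w ps → ∃[ qs ] Path w u qs × qs ⊆ ps
  reverse (single u) = _ , single u , λ q → q
  reverse (cons {ps = ps} u~y u∉ p) with reverse p
  ... | qs , q , qs⊆ = _ , snoc q (sym G u~y) (λ r → u∉ (qs⊆ r)) , ⊆-cons
    where
      ⊆-cons : qs ++ _ ∷ [] ⊆ _ ∷ ps
      ⊆-cons r with ∈-++⁻ qs r
      ... | inj₁ r′         = there (qs⊆ r′)
      ... | inj₂ (here refl) = here refl

  record Joined (u w : Fin n) (ps qs : List (Fin n)) : Set where
    field
      vertices : List (Fin n)
      path     : Path u w vertices
      ⊇ˡ       : ps ⊆ vertices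
      ⊇ʳ       : qs ⊆ vertices
      ⊆∪       : ∀ {y} → y ∈ vertices → y ∈ ps ⊎ y ∈ qs

  join : Path u x ps → Path x w qs → (∀ {y} → y ∈ ps → y ∈ qs → y ≡ x) → Joined u w ps qs
  join (single _) q _ = record
    { vertices = _ ; path = q
    ; ⊇ˡ = λ { (here refl) → head∈ q } ; ⊇ʳ = λ r → r ; ⊆∪ = inj₂ }
  join (cons {ps = ps} u~y u∉ p) q meet = record
    { vertices = _ ∷ vertices ; path = cons u~y u∉vertices path
    ; ⊇ˡ = λ { (here refl) → here refl ; (there r) → there (⊇ˡ r) }
    ; ⊇ʳ = λ r → there (⊇ʳ r)
    ; ⊆∪ = λ { (here refl) → inj₁ (here refl) ; (there r) → Sum.map₁ there (⊆∪ r) } }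
    where
      open Joined (join p q (λ r → meet (there r)))
      u∉vertices : _ ∉ vertices
      u∉vertices r with ⊆∪ r
      ... | inj₁ u∈ps = u∉ u∈ps
      ... | inj₂ u∈qs = u∉ (subst (_∈ ps) (≡.sym (meet (here refl) u∈qs)) (last∈ p))

  sub-path : Path u w ps → x ∈ ps → y ∈ ps → ∃[ qs ] Path x y qs × qs ⊆ ps
  sub-path p x∈ y∈ with split-at p x∈
  ... | s with SplitAt.cover s y∈
  ... | inj₂ y∈after =
    let open SplitAt (split-at (SplitAt.final s) y∈after)
    in  _ , initial , λ r → SplitAt.after⊆ s (before⊆ r)
  ... | inj₁ y∈before =
    let open SplitAt (split-at (SplitAt.initial s) y∈before)
        qs , q , qs⊆ = reverse final
    in  qs , q , λ r → SplitAt.before⊆ s (after⊆ (qs⊆ r))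

  path-from-reach : u ∉ S → Reach G S u w → ∃[ ps ] Path u w ps × VertexDisjoint G ps S
  path-from-reach u∉S here = _ , single _ , λ { _ (here refl) → u∉S }
  path-from-reach {u = u} u∉S (step u~y y∉S r) with path-from-reach y∉S r
  ... | ps , p , avoid with u ∈? ps
  ... | yes u∈ps = after , final , λ y q → avoid y (after⊆ q)
    where open SplitAt (split-at p u∈ps)
  ... | no u∉ps = u ∷ ps , cons u~y u∉ps p , λ { _ (here refl) → u∉S ; y (there q) → avoid y q }

  linked-snoc : Path u w ps → Adj G w x → Linked (Adj G) (ps ++ x ∷ [])
  linked-snoc (single _)                    w~x = w~x ∷ [-]
  linked-snoc (cons u~y _ (single _))       w~x = u~y ∷ w~x ∷ [-]
  linked-snoc (cons u~y _ p@(cons _ _ _))   w~x = u~y ∷ linked-snoc p w~x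

  path⇒cycle : Path u w ps → Adj G w u → 3 ≤ length ps → IsCycle G ps
  path⇒cycle (single _)     _   (s≤s ())
  path⇒cycle p@(cons _ _ _) w~u 3≤ = 3≤ , unique p , _ , _ , refl , linked-snoc p w~u

  unique-linked⇒path : Unique (x ∷ ps) → Linked (Adj G) (x ∷ ps) → ∃[ w ] Path x w (x ∷ ps)
  unique-linked⇒path {ps = []}    _            _           = _ , single _
  unique-linked⇒path {ps = _ ∷ _} (x∉ ∷ uniq) (x~y ∷ linked) with unique-linked⇒path uniq linked
  ... | w , p = w , cons x~y (All¬⇒¬Any x∉) p

  cycle⇒path : IsCycle G ps → ∃[ u ] ∃[ w ] Path u w ps
  cycle⇒path (_ , uniq , x , xs , refl , linked) =
    x , unique-linked⇒path uniq (linked-++⁻ˡ (x ∷ xs) linked)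

  cycle-arc : IsCycle G ps → x ∈ ps → y ∈ ps → ∃[ qs ] Path x y qs × qs ⊆ ps
  cycle-arc cyc = sub-path (proj₂ (proj₂ (cycle⇒path cyc)))

  another-vertex : IsCycle G ps → ∀ a → ∃[ b ] b ∈ ps × b ≢ a
  another-vertex (s≤s () , _ , _ , [] , refl , _) a
  another-vertex (_ , ((x≢y ∷ _) ∷ _) , x , y ∷ _ , refl , _) a with x ≟ a
  ... | yes refl = y , there (here refl) , λ y≡x → x≢y (≡.sym y≡x)
  ... | no x≢a   = x , here refl , x≢a

  record CycleOver (x : Fin n) (ps qs rs : List (Fin n)) : Set where
    field
      vertices : List (Fin n)
      cycle    : IsCycle G vertices
      x∈       : x ∈ vertices
      cover    : ∀ {u} → u ∈ vertices → u ∈ ps ⊎ u ∈ qs ⊎ u ∈ rs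

  triangle-cycle : Path x y ps → Path y z qs → Path z x rs →
    (∀ {u} → u ∈ ps → u ∈ qs → u ≡ y) → (∀ {u} → u ∈ qs → u ∈ rs → u ≡ z) →
    (∀ {u} → u ∈ rs → u ∈ ps → u ≡ x) →
    x ≢ y → y ≢ z → x ≢ z → CycleOver x ps qs rs
  triangle-cycle (single _) _ _ _ _ _ x≢x _ _ = ⊥-elim (x≢x refl)
  triangle-cycle {x = x} {y = y} {ps = x ∷ ps} {qs = qs} {rs = rs}
                 (cons x~x′ x∉ps P) Q R PQ QR RP x≢y y≢z x≢z = record
    { vertices = vertices
    ; cycle    = path⇒cycle path x~x′ (distinct₃⇒3≤length
                   (last∈ path) (⊇ˡ (last∈ P)) (⊇ʳ (QR.⊇ˡ (last∈ Q))) x≢y y≢z x≢z)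
    ; x∈       = last∈ path
    ; cover    = cover }
    where
      module QR = Joined (join Q R QR)
      P∩QR : ∀ {u} → u ∈ ps → u ∈ QR.vertices → u ≡ y
      P∩QR u∈P u∈QR with QR.⊆∪ u∈QR
      ... | inj₁ u∈Q = PQ (there u∈P) u∈Q
      ... | inj₂ u∈R = ⊥-elim (x∉ps (subst (_∈ ps) (RP u∈R (there u∈P)) u∈P))
      open Joined (join P QR.path P∩QR)
      cover : ∀ {u} → u ∈ vertices → u ∈ x ∷ ps ⊎ u ∈ qs ⊎ u ∈ rs
      cover u∈ with ⊆∪ u∈
      ... | inj₁ u∈P  = inj₁ (there u∈P)
      ... | inj₂ u∈QR = inj₂ (QR.⊆∪ u∈QR)

  disjoint-sym : VertexDisjoint G ps qs → VertexDisjoint G qs ps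
  disjoint-sym ps∩qs x x∈qs x∈ps = ps∩qs x x∈ps x∈qs

module Approaches {n : ℕ} (G : Graph n) (v : Fin n) where

  open Paths G
  open import Data.List.Membership.DecPropositional (_≟_ {n}) using (_∈?_)

  private variable
    T : Fin n → Set
    x : Fin n
    ps C D X Y : List (Fin n)

  record Approach (X Y : List (Fin n)) : Set where
    field
      end      : Fin n
      vertices : List (Fin n)
      path     : Path v end vertices
      end∈     : end ∈ X
      only-end : ∀ {y} → y ∈ vertices → y ∈ X ⊎ y ∈ Y → y ≡ end

  ∣_∣ : Approach X Y → ℕ
  ∣ P ∣ = length (Approach.vertices P)

  1≤∣_∣ : (P : Approach X Y) → 1 ≤ ∣ P ∣
  1≤∣ P ∣ = ∈-length (head∈ (Approach.path P))

  approach-avoids : VertexDisjoint G X Y → (P : Approach X Y) → VertexDisjoint G (Approach.vertices P) Y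
  approach-avoids {X = X} X∩Y P y y∈P y∈Y =
    X∩Y y (subst (_∈ X) (≡.sym (only-end y∈P (inj₂ y∈Y))) end∈) y∈Y
    where open Approach P

  record Entry (X Y ps : List (Fin n)) (x : Fin n) : Set where
    field
      approach : Approach X Y
    open Approach approach public
    field
      ⊆ps : vertices ⊆ ps
      ≤ps : length vertices ≤ length ps
      <ps : end ≢ x → length vertices < length ps

  entry : (h : FirstHit T v x ps) → FirstHit.hit h ∈ X →
          (∀ {y} → y ∈ FirstHit.before h → y ∈ X ⊎ y ∈ Y → y ≡ FirstHit.hit h) →
          Entry X Y ps x
  entry h hit∈X only = record
    { approach = record
        { end = hit ; vertices = before ; path = initial ; end∈ = hit∈X ; only-end = only }
    ; ⊆ps = before⊆ ; ≤ps = before-≤ ; <ps = before-< }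
    where open FirstHit h

  first-entry : Path v x ps → x ∈ C ⊎ x ∈ D → Entry C D ps x ⊎ Entry D C ps x
  first-entry {C = C} {D = D} p x∈ with first-hit (λ y → (y ∈? C) ⊎-dec (y ∈? D)) p
  ... | inj₁ none = ⊥-elim (none (last∈ p) x∈)
  ... | inj₂ h with FirstHit.T-hit h
  ... | inj₁ hit∈C = inj₁ (entry h hit∈C (FirstHit.first h))
  ... | inj₂ hit∈D = inj₂ (entry h hit∈D (λ q t → FirstHit.first h q (swap t)))

  record Rerouted (Y : List (Fin n)) (ℓ : ℕ) : Set where
    field
      X′       : List (Fin n)
      cycle    : IsCycle G X′
      disjoint : VertexDisjoint G X′ Y
      approach : Approach X′ Y
      shorter  : ∣ approach ∣ < ℓ

  module _ (cX : IsCycle G X) (X∩Y : VertexDisjoint G X Y) (P R : Approach X Y)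
           (a∉R : Approach.end P ∉ Approach.vertices R) where

    private
      module P = Approach P
      module R = Approach R

    reroute-via : ∀ {p bs} → Path R.end p bs → bs ⊆ R.vertices → p ∈ P.vertices →
                  (∀ {u} → u ∈ bs → u ∈ P.vertices → u ≡ p) → Rerouted Y ∣ P ∣
    reroute-via {p} {bs} B B⊆R p∈P B∩P = record
      { X′ = vertices ; cycle = cycle ; disjoint = disjoint
      ; approach = record
          { end = p ; vertices = S.before ; path = S.initial ; end∈ = x∈ ; only-end = only-p }
      ; shorter = S.before-< p≢a }
      where
        module S = SplitAt (split-at P.path p∈P)
        arc : ∃[ as ] Path P.end R.end as × as ⊆ X
        arc = cycle-arc cX P.end∈ R.end∈
        A⊆X : proj₁ arc ⊆ X
        A⊆X = proj₂ (proj₂ arc)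
        a≢w : P.end ≢ R.end
        a≢w = ∈∉⇒≢ (last∈ R.path) a∉R
        p≢a : p ≢ P.end
        p≢a p≡a = a∉R (subst (_∈ R.vertices) p≡a (B⊆R (last∈ B)))
        p≢w : p ≢ R.end
        p≢w p≡w = a≢w (≡.sym (P.only-end (subst (_∈ P.vertices) p≡w p∈P) (inj₁ R.end∈)))
        open CycleOver (triangle-cycle S.final (proj₁ (proj₂ arc)) B
          (λ u∈P u∈A → P.only-end (S.after⊆ u∈P) (inj₁ (A⊆X u∈A)))
          (λ u∈A u∈B → R.only-end (B⊆R u∈B) (inj₁ (A⊆X u∈A)))
          (λ u∈B u∈P → B∩P u∈B (S.after⊆ u∈P))
          p≢a a≢w p≢w)
        disjoint : VertexDisjoint G vertices Y
        disjoint u u∈ with cover u∈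
        ... | inj₁ u∈P         = approach-avoids X∩Y P u (S.after⊆ u∈P)
        ... | inj₂ (inj₁ u∈A) = X∩Y u (A⊆X u∈A)
        ... | inj₂ (inj₂ u∈B) = approach-avoids X∩Y R u (B⊆R u∈B)
        only-p : ∀ {u} → u ∈ S.before → u ∈ vertices ⊎ u ∈ Y → u ≡ p
        only-p u∈ (inj₂ u∈Y) = ⊥-elim (approach-avoids X∩Y P _ (S.before⊆ u∈) u∈Y)
        only-p u∈ (inj₁ u∈C) with cover u∈C
        ... | inj₁ u∈P         = S.meet u∈ u∈P
        ... | inj₂ (inj₂ u∈B) = B∩P u∈B (S.before⊆ u∈)
        ... | inj₂ (inj₁ u∈A) = ⊥-elim (p≢a (≡.sym (S.meet a∈before (last∈ S.final))))
          where
            a∈before : P.end ∈ S.before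
            a∈before = subst (_∈ S.before) (P.only-end (S.before⊆ u∈) (inj₁ (A⊆X u∈A))) u∈

    reroute : Rerouted Y ∣ P ∣
    reroute with reverse R.path
    ... | _ , R⁻ , R⁻⊆R with first-hit (_∈? P.vertices) R⁻
    ... | inj₁ none = ⊥-elim (none (last∈ R⁻) (head∈ P.path))
    ... | inj₂ h = reroute-via initial (λ u∈ → R⁻⊆R (before⊆ u∈)) T-hit first
      where open FirstHit h

module Proof {n : ℕ} (G : Graph n) (conn : KConnected G 3) (v : Fin n)
             (no-cycles-through-v : ¬ HasDisjointCyclesThrough G v) where

  open Paths G
  open Approaches G v

  private variable
    x : Fin n
    C D : List (Fin n)

  v∉cycle : IsCycle G C → IsCycle G D → VertexDisjoint G C D → v ∉ C
  v∉cycle cC cD C∩D v∈C = no-cycles-through-v (_ , _ , cC , cD , C∩D , inj₁ v∈C)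

  enter-avoiding : ∀ S → length S < 3 → v ∉ S → x ∉ S → x ∈ C →
    (Σ[ R ∈ Approach C D ] VertexDisjoint G (Approach.vertices R) S) ⊎
    (Σ[ R ∈ Approach D C ] VertexDisjoint G (Approach.vertices R) S)
  enter-avoiding S small v∉S x∉S x∈C
    with path-from-reach v∉S (proj₂ conn S small v _ v∉S x∉S)
  ... | ws , W , W∩S with first-entry W (inj₁ x∈C)
  ... | inj₁ E = inj₁ (Entry.approach E , λ u u∈ → W∩S u (Entry.⊆ps E u∈))
  ... | inj₂ E = inj₂ (Entry.approach E , λ u u∈ → W∩S u (Entry.⊆ps E u∈))

  NoApproach : ℕ → Set
  NoApproach ℓ = ∀ {C D} → IsCycle G C → IsCycle G D → VertexDisjoint G C D →
                 (P : Approach C D) → ∣ P ∣ ≤ ℓ → ⊥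

  rerouted-impossible : ∀ {ℓ k} → NoApproach ℓ → IsCycle G D → Rerouted D k →
                        k ≤ suc ℓ → ⊥
  rerouted-impossible IH cD r k≤ = IH cycle cD disjoint approach (≤-pred (≤-trans shorter k≤))
    where open Rerouted r

  two-approaches : ∀ {ℓ} → NoApproach ℓ → ∀ m →
    IsCycle G C → IsCycle G D → VertexDisjoint G C D →
    (P : Approach C D) → ∣ P ∣ ≤ suc ℓ → (Q : Approach D C) → ∣ Q ∣ ≤ m → ⊥
  two-approaches IH zero _ _ _ _ _ Q Q≤0 with ≤-trans 1≤∣ Q ∣ Q≤0
  ... | ()
  two-approaches {C = C} {D = D} IH (suc m) cC cD C∩D P P≤ Q Q≤
    with another-vertex cC (Approach.end P)
  ... | c , c∈C , c≢a =
    [ (λ (R , R∩az) → rerouted-impossible IH cD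
                        (reroute cC C∩D P R (disjoint-sym R∩az a (here refl))) P≤)
    , (λ (R , R∩az) → replace-D
                        (reroute cD (disjoint-sym C∩D) Q R (disjoint-sym R∩az z (there (here refl)))))
    ]′ (enter-avoiding (a ∷ z ∷ []) (s≤s (s≤s (s≤s z≤n))) v∉az c∉az c∈C)
    where
      open Approach P using () renaming (end to a; end∈ to a∈C)
      open Approach Q using () renaming (end to z; end∈ to z∈D)
      v∉az : v ∉ a ∷ z ∷ []
      v∉az = All¬⇒¬Any (∈∉⇒≢ a∈C (v∉cycle cC cD C∩D)
                      ∷ ∈∉⇒≢ z∈D (v∉cycle cD cC (disjoint-sym C∩D)) ∷ [])
      c∉az : c ∉ a ∷ z ∷ []
      c∉az = All¬⇒¬Any (c≢a ∷ ∈∉⇒≢ z∈D (C∩D c c∈C) ∷ [])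
      replace-D : Rerouted C ∣ Q ∣ → ⊥
      replace-D r with first-entry (Approach.path P) (inj₁ a∈C)
      ... | inj₁ E = two-approaches IH m cC cycle (disjoint-sym disjoint)
                       (Entry.approach E) (≤-trans (Entry.≤ps E) P≤)
                       approach (≤-pred (≤-trans shorter Q≤))
        where open Rerouted r
      ... | inj₂ E = IH cycle cC disjoint (Entry.approach E)
                       (≤-pred (≤-trans (Entry.<ps E end≢a) P≤))
        where
          open Rerouted r
          end≢a : Entry.end E ≢ a
          end≢a = ∈∉⇒≢ a∈C (disjoint _ (Entry.end∈ E))

  no-approach : ∀ ℓ → NoApproach ℓ
  no-approach zero _ _ _ P P≤0 with ≤-trans 1≤∣ P ∣ P≤0
  ... | ()
  no-approach (suc ℓ) cC cD C∩D P P≤ with another-vertex cC (Approach.end P)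
  ... | c , c∈C , c≢a =
    [ (λ (R , R∩a) → rerouted-impossible IH cD
                       (reroute cC C∩D P R (disjoint-sym R∩a a (here refl))) P≤)
    , (λ (Q , _) → two-approaches IH ∣ Q ∣ cC cD C∩D P P≤ Q ≤-refl)
    ]′ (enter-avoiding (a ∷ []) (s≤s (s≤s z≤n))
         (All¬⇒¬Any (∈∉⇒≢ a∈C (v∉cycle cC cD C∩D) ∷ []))
         (All¬⇒¬Any (c≢a ∷ [])) c∈C)
    where
      open Approach P using () renaming (end to a; end∈ to a∈C)
      IH : NoApproach ℓ
      IH = no-approach ℓ

  no-disjoint-cycles : ¬ HasDisjointCycles G
  no-disjoint-cycles (C , D , cC , cD , C∩D) =
    [ (λ (P , _) → no-approach ∣ P ∣ cC cD C∩D P ≤-refl)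
    , (λ (P , _) → no-approach ∣ P ∣ cD cC (disjoint-sym C∩D) P ≤-refl)
    ]′ (enter-avoiding [] (s≤s z≤n) (λ ()) (λ ()) (head∈ (proj₂ (proj₂ (cycle⇒path cC)))))

proposition1p8 : (n : ℕ) (G : Graph n) → KConnected G 3 → (v : Fin n) →
    ¬ HasDisjointCyclesThrough G v → ¬ HasDisjointCycles G
proposition1p8 n G conn v no-cycles-through-v = Proof.no-disjoint-cycles G conn v no-cycles-through-v
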